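{- Let $h$ be a positive integer and let $S$ be an inverse-closed subset of $\mathbb{Z}_{4h}$. Let $K$ be a subgroup of $\mathbb{Z}_{4h}$ whose order is twice an odd integer, and let $K_o=K\setminus 2K$. If $(S\setminus K_o)+\langle h\rangle\subseteq S\cup K_o$, then the Cayley graph $\mathrm{Cay}\big(\mathbb{Z}_{4h},(S\setminus\{2h\})+2h\big)$ has an automorphism fixing $0$ but moving $2h$.
   Context: For an additive group $G$ and an inverse-closed subset $T\subseteq G$ not containing $0$, the Cayley graph $\mathrm{Cay}(G,T)$ has vertex set $G$, with $x\sim y$ iff $y-x\in T$. For subsets $A,B$ and an element $g$, $A+B=\{a+b\}$, $A+g=\{a+g:a\in A\}$, $2K=\{2k:k\in K\}$, and $\langle h\rangle$ is the cyclic subgroup generated by $h$. -}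

module Defs where

open import Data.Nat using (ℕ; zero; suc; _+_; _*_; _∸_; NonZero)
open import Data.Nat.DivMod using (_mod_)
open import Data.Fin using (Fin; toℕ)
open import Data.Fin.Subset using (Subset; _∈_; _∉_; ∣_∣)
open import Data.Product using (Σ; ∃; _×_; _,_)
open import Data.Sum using (_⊎_)
open import Relation.Nullary using (¬_)
open import Relation.Binary.PropositionalEquality using (_≡_; _≢_)
open import Function.Bundles using (_⤖_; Bijection)
open import Function using (_⇔_)

module Zn (n : ℕ) .{{_ : NonZero n}} where

  [_] : ℕ → Fin n
  [ k ] = k mod n

  0ₙ : Fin n
  0ₙ = [ 0 ]

  _⊕_ : Fin n → Fin n → Fin n
  a ⊕ b = [ toℕ a + toℕ b ]

  ⊖_ : Fin n → Fin n
  ⊖ a = [ n ∸ toℕ a ]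

  _⊖_ : Fin n → Fin n → Fin n
  a ⊖ b = a ⊕ (⊖ b)

  InverseClosed : Subset n → Set
  InverseClosed S = ∀ x → x ∈ S → ⊖ x ∈ S

  IsSubgroup : Subset n → Set
  IsSubgroup K = (0ₙ ∈ K) × (∀ x y → x ∈ K → y ∈ K → x ⊕ y ∈ K) × (∀ x → x ∈ K → ⊖ x ∈ K)

  OrderTwiceOdd : Subset n → Set
  OrderTwiceOdd K = ∃ λ m → ∣ K ∣ ≡ 2 * (1 + 2 * m)

  In2 : Subset n → Fin n → Set
  In2 K x = Σ (Fin n) λ k → k ∈ K × x ≡ k ⊕ k

  InKo : Subset n → Fin n → Set
  InKo K x = x ∈ K × ¬ In2 K x

  InCyclic : Fin n → Fin n → Set
  InCyclic g x = ∃ λ j → x ≡ [ j * toℕ g ]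

  CayAdj : (Fin n → Set) → Fin n → Fin n → Set
  CayAdj T x y = T (y ⊖ x)

  IsCayAut : (Fin n → Set) → (Fin n → Fin n) → Set
  IsCayAut T f = ∀ x y → CayAdj T x y ⇔ CayAdj T (f x) (f y)

-- Put t = 2h. As ∣K∣ = 2M with M = 1 + 2m odd, Lagrange (∣K∣·k = 0 for k ∈ K) makes u = M·k satisfy
-- u + u = 0, so u ∈ {0, t}. This gives t ∉ 2K (t = k + k would give t = M·t = 2M·k = 0) and k + t ∈ 2K for
-- every k ∈ K_o (k + M·k = 2((1 + m)·k) ∈ 2K, and u = 0 would put k in 2K). Hence h, 2h ∉ 2K, and the
-- map exchanging the cosets 2K + h and 2K + 2h by translation by ±h, fixing every other coset of 2K,
-- is an involution fixing 0 and sending 2h to h. It keeps differences lying in 2K and moves any other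
-- difference d = s + 2h (s ∈ S) to d + c with c ∈ ⟨h⟩ and d + c ∉ 2K. Then s ∉ K_o, the hypothesis
-- puts s + c in S or K_o, and both K_o and s + c = 2h would force d + c ∈ 2K; so d + c is again in
-- (S ∖ {2h}) + 2h.

module Submission where

open import Defs
open import Algebra.Bundles using (AbelianGroup)
open import Algebra.Structures using (IsAbelianGroup)
open import Data.Bool.Base using (Bool; true; false; if_then_else_)
open import Data.Empty using (⊥-elim)
open import Data.Fin using (Fin; toℕ)
open import Data.Fin.Permutation using (Permutation; permutation)
open import Data.Fin.Properties using (any?; _≟_; toℕ-injective; toℕ<n; toℕ-fromℕ<)
open import Data.Fin.Subset using (Subset; _∈_; ∣_∣)
open import Data.Fin.Subset.Properties using (_∈?_)
open import Data.Nat using (ℕ; zero; suc; _+_; _*_; _∸_; _%_; _<_; _≤_; NonZero; pred; ⌊_/2⌋; >-nonZero⁻¹; ≢-nonZero⁻¹)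
open import Data.Nat.Divisibility using (_∣_; divides; m%n≡0⇒n∣m)
open import Data.Nat.DivMod using (m%n<n; m<n⇒m%n≡m; n%n≡0; %-distribˡ-+; m*n%n≡0)
open import Data.Nat.Properties
  using ( +-identityʳ; +-comm; +-assoc; *-identityˡ; *-comm; *-suc; *-distribˡ-+; *-distribʳ-+
        ; suc-pred; m+[n∸m]≡n; m+n≡0⇒m≡0; n≡⌊n+n/2⌋; n≢0⇒n>0; m<m+n; m≤m+n; <⇒≤; <⇒≱; +-mono-<; +-monoʳ-≤)
open import Data.Product using (Σ; _×_; _,_)
open import Data.Sum using (_⊎_; inj₁; inj₂)
open import Data.Vec.Base using ([]; _∷_)
open import Function using (_∘_; mk⇔)
open import Function.Bundles using (_⤖_; Bijection; mk↔ₛ′)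
open import Function.Properties.Inverse using (↔⇒⤖)
open import Level using (0ℓ)
open import Relation.Binary.PropositionalEquality hiding ([_])
open import Relation.Nullary using (¬_; Dec; yes; no; does)
open import Relation.Nullary.Decidable using (dec-true; dec-false; does-≡; map′; _×-dec_)
open import Relation.Unary using (Decidable)

module ZnGroup (n : ℕ) .{{_ : NonZero n}} where
  open Zn n
  open ≡-Reasoning

  toℕ-[] : ∀ k → toℕ [ k ] ≡ k % n
  toℕ-[] k = toℕ-fromℕ< (m%n<n k n)

  0%n≡0 : 0 % n ≡ 0
  0%n≡0 = m<n⇒m%n≡m (>-nonZero⁻¹ n)

  toℕ-0ₙ : toℕ 0ₙ ≡ 0
  toℕ-0ₙ = trans (toℕ-[] 0) 0%n≡0

  [toℕ] : ∀ x → [ toℕ x ] ≡ x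
  [toℕ] x = toℕ-injective (trans (toℕ-[] (toℕ x)) (m<n⇒m%n≡m (toℕ<n x)))

  []-cong-% : ∀ {a b} → a % n ≡ b % n → [ a ] ≡ [ b ]
  []-cong-% {a} {b} eq = toℕ-injective (trans (toℕ-[] a) (trans eq (sym (toℕ-[] b))))

  []-homo-+ : ∀ a b → [ a ] ⊕ [ b ] ≡ [ a + b ]
  []-homo-+ a b = []-cong-% (begin
    (toℕ [ a ] + toℕ [ b ]) % n ≡⟨ cong₂ (λ u v → (u + v) % n) (toℕ-[] a) (toℕ-[] b) ⟩
    (a % n + b % n) % n         ≡⟨ %-distribˡ-+ a b n ⟨
    (a + b) % n                 ∎)

  [n]≡0ₙ : [ n ] ≡ 0ₙ
  [n]≡0ₙ = []-cong-% (trans (n%n≡0 n) (sym 0%n≡0))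

  [n*k]≡0ₙ : ∀ k → [ n * k ] ≡ 0ₙ
  [n*k]≡0ₙ k = []-cong-% (trans (cong (_% n) (*-comm n k)) (trans (m*n%n≡0 k n) (sym 0%n≡0)))

  ⊕-comm : ∀ x y → x ⊕ y ≡ y ⊕ x
  ⊕-comm x y = cong [_] (+-comm (toℕ x) (toℕ y))

  ⊕-assoc : ∀ x y z → (x ⊕ y) ⊕ z ≡ x ⊕ (y ⊕ z)
  ⊕-assoc x y z = begin
    [ toℕ x + toℕ y ] ⊕ z         ≡⟨ cong ([ toℕ x + toℕ y ] ⊕_) ([toℕ] z) ⟨
    [ toℕ x + toℕ y ] ⊕ [ toℕ z ] ≡⟨ []-homo-+ _ _ ⟩
    [ toℕ x + toℕ y + toℕ z ]     ≡⟨ cong [_] (+-assoc (toℕ x) _ _) ⟩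
    [ toℕ x + (toℕ y + toℕ z) ]   ≡⟨ []-homo-+ _ _ ⟨
    [ toℕ x ] ⊕ (y ⊕ z)           ≡⟨ cong (_⊕ (y ⊕ z)) ([toℕ] x) ⟩
    x ⊕ (y ⊕ z)                   ∎

  ⊕-identityˡ : ∀ x → 0ₙ ⊕ x ≡ x
  ⊕-identityˡ x = trans (cong (λ k → [ k + toℕ x ]) toℕ-0ₙ) ([toℕ] x)

  ⊕-identityʳ : ∀ x → x ⊕ 0ₙ ≡ x
  ⊕-identityʳ x = trans (⊕-comm x 0ₙ) (⊕-identityˡ x)

  ⊕-inverseʳ : ∀ x → x ⊕ (⊖ x) ≡ 0ₙ
  ⊕-inverseʳ x = begin
    x ⊕ [ n ∸ toℕ x ]         ≡⟨ cong (_⊕ [ n ∸ toℕ x ]) ([toℕ] x) ⟨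
    [ toℕ x ] ⊕ [ n ∸ toℕ x ] ≡⟨ []-homo-+ _ _ ⟩
    [ toℕ x + (n ∸ toℕ x) ]   ≡⟨ cong [_] (m+[n∸m]≡n (<⇒≤ (toℕ<n x))) ⟩
    [ n ]                     ≡⟨ [n]≡0ₙ ⟩
    0ₙ                        ∎

  ⊕-inverseˡ : ∀ x → (⊖ x) ⊕ x ≡ 0ₙ
  ⊕-inverseˡ x = trans (⊕-comm (⊖ x) x) (⊕-inverseʳ x)

  isAbelianGroup : IsAbelianGroup _≡_ _⊕_ 0ₙ (λ x → ⊖ x)
  isAbelianGroup = record
    { isGroup = record
      { isMonoid = record
        { isSemigroup = record
          { isMagma = record { isEquivalence = isEquivalence ; ∙-cong = cong₂ _⊕_ }
          ; assoc = ⊕-assoc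
          }
        ; identity = ⊕-identityˡ , ⊕-identityʳ
        }
      ; inverse = ⊕-inverseˡ , ⊕-inverseʳ
      ; ⁻¹-cong = cong (λ x → ⊖ x)
      }
    ; comm = ⊕-comm
    }

  abelianGroup : AbelianGroup 0ℓ 0ℓ
  abelianGroup = record { isAbelianGroup = isAbelianGroup }

  open AbelianGroup abelianGroup public using (monoid; commutativeMonoid; commutativeSemigroup)
  open import Algebra.Properties.AbelianGroup abelianGroup public
    using ( ⁻¹-involutive; ⁻¹-∙-comm; ⁻¹-anti-homo-//; ε⁻¹≈ε; xyx⁻¹≈y; inverseʳ-unique; identityʳ-unique
          ; //-rightDividesˡ; //-rightDividesʳ; \\-leftDividesʳ)
  open import Algebra.Properties.CommutativeSemigroup commutativeSemigroup public
    using (interchange; xy∙z≈xz∙y)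
  open import Algebra.Properties.Monoid.Mult monoid public
    using (×-homo-+; ×-assocˡ) renaming (_×_ to _·_)
  open import Algebra.Properties.CommutativeMonoid.Mult commutativeMonoid public
    using (×-distrib-+)

  [x⊕c]⊖[y⊕d]≡[x⊖y]⊕[c⊖d] : ∀ x c y d → (x ⊕ c) ⊖ (y ⊕ d) ≡ (x ⊖ y) ⊕ (c ⊖ d)
  [x⊕c]⊖[y⊕d]≡[x⊖y]⊕[c⊖d] x c y d =
    trans (cong ((x ⊕ c) ⊕_) (sym (⁻¹-∙-comm y d))) (interchange x c (⊖ y) (⊖ d))

  ·-[] : ∀ j x → j · x ≡ [ j * toℕ x ]
  ·-[] zero    x = refl
  ·-[] (suc j) x = trans (cong₂ _⊕_ (sym ([toℕ] x)) (·-[] j x)) ([]-homo-+ (toℕ x) (j * toℕ x))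

  ·-zeroʳ : ∀ j → j · 0ₙ ≡ 0ₙ
  ·-zeroʳ zero    = refl
  ·-zeroʳ (suc j) = trans (⊕-identityˡ (j · 0ₙ)) (·-zeroʳ j)

  ·-double : ∀ j x → (j · x) ⊕ (j · x) ≡ (2 * j) · x
  ·-double j x = trans (sym (×-homo-+ x j j)) (cong (_· x) (cong (j +_) (sym (+-identityʳ j))))

  n·x≡0ₙ : ∀ x → n · x ≡ 0ₙ
  n·x≡0ₙ x = trans (·-[] n x) ([n*k]≡0ₙ (toℕ x))

  ⊖-· : ∀ j x → ⊖ (j · x) ≡ (j * pred n) · x
  ⊖-· j x = sym (inverseʳ-unique (j · x) ((j * pred n) · x) (begin
    (j · x) ⊕ ((j * pred n) · x) ≡⟨ ×-homo-+ x j (j * pred n) ⟨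
    (j + j * pred n) · x         ≡⟨ cong (_· x) (trans (sym (*-suc j (pred n))) (cong (j *_) (suc-pred n))) ⟩
    (j * n) · x                  ≡⟨ ×-assocˡ x j n ⟨
    j · (n · x)                  ≡⟨ cong (j ·_) (n·x≡0ₙ x) ⟩
    j · 0ₙ                       ≡⟨ ·-zeroʳ j ⟩
    0ₙ                           ∎))

  [1+2m]·u≡u : ∀ m {u} → u ⊕ u ≡ 0ₙ → (1 + 2 * m) · u ≡ u
  [1+2m]·u≡u m {u} u⊕u≡0ₙ = begin
    u ⊕ ((2 * m) · u)         ≡⟨ cong (u ⊕_) (·-double m u) ⟨
    u ⊕ ((m · u) ⊕ (m · u))   ≡⟨ cong (u ⊕_) (×-distrib-+ u u m) ⟨
    u ⊕ (m · (u ⊕ u))         ≡⟨ cong (λ v → u ⊕ (m · v)) u⊕u≡0ₙ ⟩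
    u ⊕ (m · 0ₙ)              ≡⟨ cong (u ⊕_) (·-zeroʳ m) ⟩
    u ⊕ 0ₙ                    ≡⟨ ⊕-identityʳ u ⟩
    u                         ∎

  involutive⇒IsCayAut : ∀ {T f} → (∀ x → f (f x) ≡ x) →
    (∀ x y → CayAdj T x y → CayAdj T (f x) (f y)) → IsCayAut T f
  involutive⇒IsCayAut {T} {f} f-involutive f-preserves x y = mk⇔ (f-preserves x y)
    (λ adj → subst₂ (CayAdj T) (f-involutive x) (f-involutive y) (f-preserves (f x) (f y) adj))

module Subgroups (n : ℕ) .{{_ : NonZero n}} where
  open Zn n
  open ZnGroup n
  open ≡-Reasoning

  record IsSubgroupPred (H : Fin n → Set) : Set where
    field
      0ₙ∈ : H 0ₙ
      ⊕-closed : ∀ {x y} → H x → H y → H (x ⊕ y)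
      ⊖-closed : ∀ {x} → H x → H (⊖ x)

    ·-closed : ∀ j {x} → H x → H (j · x)
    ·-closed zero    _   = 0ₙ∈
    ·-closed (suc j) x∈H = ⊕-closed x∈H (·-closed j x∈H)

  ∈-isSubgroupPred : ∀ {K} → IsSubgroup K → IsSubgroupPred (_∈ K)
  ∈-isSubgroupPred (0ₙ∈K , ⊕-closed , ⊖-closed) = record
    { 0ₙ∈ = 0ₙ∈K
    ; ⊕-closed = ⊕-closed _ _
    ; ⊖-closed = ⊖-closed _
    }

  In2-isSubgroupPred : ∀ {K} → IsSubgroup K → IsSubgroupPred (In2 K)
  In2-isSubgroupPred {K} K≤ = record
    { 0ₙ∈ = 0ₙ , 0ₙ∈ , sym (⊕-identityˡ 0ₙ)
    ; ⊕-closed = λ { (k , k∈K , x≡k⊕k) (l , l∈K , y≡l⊕l) →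
        k ⊕ l , ⊕-closed k∈K l∈K , trans (cong₂ _⊕_ x≡k⊕k y≡l⊕l) (interchange k k l l) }
    ; ⊖-closed = λ { (k , k∈K , x≡k⊕k) →
        ⊖ k , ⊖-closed k∈K , trans (cong (λ x → ⊖ x) x≡k⊕k) (sym (⁻¹-∙-comm k k)) }
    }
    where open IsSubgroupPred (∈-isSubgroupPred K≤)

  In2? : ∀ K → Decidable (In2 K)
  In2? K x = any? (λ k → (k ∈? K) ×-dec (x ≟ (k ⊕ k)))

  InCyclic-isSubgroupPred : ∀ g → IsSubgroupPred (InCyclic g)
  InCyclic-isSubgroupPred g = record
    { 0ₙ∈ = 0 , refl
    ; ⊕-closed = λ { (i , refl) (j , refl) → i + j , (begin
        [ i * toℕ g ] ⊕ [ j * toℕ g ] ≡⟨ cong₂ _⊕_ (·-[] i g) (·-[] j g) ⟨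
        (i · g) ⊕ (j · g)             ≡⟨ ×-homo-+ g i j ⟨
        (i + j) · g                   ≡⟨ ·-[] (i + j) g ⟩
        [ (i + j) * toℕ g ]           ∎) }
    ; ⊖-closed = λ { (j , refl) → j * pred n , (begin
        ⊖ [ j * toℕ g ]      ≡⟨ cong (λ x → ⊖ x) (·-[] j g) ⟨
        ⊖ (j · g)            ≡⟨ ⊖-· j g ⟩
        (j * pred n) · g     ≡⟨ ·-[] (j * pred n) g ⟩
        [ j * pred n * toℕ g ] ∎) }
    }

  g∈⟨g⟩ : ∀ g → InCyclic g g
  g∈⟨g⟩ g = 1 , trans (sym ([toℕ] g)) (cong [_] (sym (*-identityˡ (toℕ g))))

  open import Algebra.Properties.CommutativeMonoid.Sum commutativeMonoid
    using (sum-syntax; sum-cong-≗; ∑-permute; ∑-distrib-+)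

  mask : ∀ {m} → Subset m → Fin m → Fin n → Fin n
  mask K i x = if does (i ∈? K) then x else 0ₙ

  mask-⊕ : ∀ {m} (K : Subset m) i x y → mask K i (x ⊕ y) ≡ mask K i x ⊕ mask K i y
  mask-⊕ K i x y with does (i ∈? K)
  ... | true  = refl
  ... | false = sym (⊕-identityˡ 0ₙ)

  ∑-mask : ∀ {m} (K : Subset m) x → ∑[ i < m ] mask K i x ≡ ∣ K ∣ · x
  ∑-mask []          x = refl
  ∑-mask (true ∷ K)  x = cong (x ⊕_) (∑-mask K x)
  ∑-mask (false ∷ K) x = trans (⊕-identityˡ _) (∑-mask K x)

  translation : Fin n → Permutation n n
  translation a = permutation (_⊕ a) (_⊖ a) (//-rightDividesˡ a) (//-rightDividesʳ a)

  module _ {K} (K≤ : IsSubgroup K) where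
    open IsSubgroupPred (∈-isSubgroupPred K≤)

    ∈?-translation : ∀ {a} → a ∈ K → ∀ i → does (i ⊕ a ∈? K) ≡ does (i ∈? K)
    ∈?-translation {a} a∈K i = does-≡ (i ⊕ a ∈? K) (map′
      (λ i∈K → ⊕-closed i∈K a∈K)
      (λ i⊕a∈K → subst (_∈ K) (//-rightDividesʳ a i) (⊕-closed i⊕a∈K (⊖-closed a∈K)))
      (i ∈? K))

    ∣K∣·a≡0ₙ : ∀ {a} → a ∈ K → ∣ K ∣ · a ≡ 0ₙ
    ∣K∣·a≡0ₙ {a} a∈K = identityʳ-unique s (∣ K ∣ · a) (sym s≡s⊕∣K∣·a)
      where
      s = ∑[ i < n ] mask K i i
      s≡s⊕∣K∣·a : s ≡ s ⊕ (∣ K ∣ · a)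
      s≡s⊕∣K∣·a = begin
        s                                    ≡⟨ ∑-permute (λ i → mask K i i) (translation a) ⟩
        ∑[ i < n ] mask K (i ⊕ a) (i ⊕ a)    ≡⟨ sum-cong-≗ (λ i →
                                                  cong (λ b → if b then i ⊕ a else 0ₙ) (∈?-translation a∈K i)) ⟩
        ∑[ i < n ] mask K i (i ⊕ a)          ≡⟨ sum-cong-≗ (λ i → mask-⊕ K i i a) ⟩
        ∑[ i < n ] (mask K i i ⊕ mask K i a) ≡⟨ ∑-distrib-+ (λ i → mask K i i) (λ i → mask K i a) ⟩
        s ⊕ (∑[ i < n ] mask K i a)          ≡⟨ cong (s ⊕_) (∑-mask K a) ⟩
        s ⊕ (∣ K ∣ · a)                      ∎

module CosetSwap (n : ℕ) .{{_ : NonZero n}} {H : Fin n → Set}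
  (H≤ : Subgroups.IsSubgroupPred n H) (H? : Decidable H) {a : Fin n} (a∉H : ¬ H a) where
  open Zn n
  open ZnGroup n
  open Subgroups n
  open IsSubgroupPred H≤
  module ⟨a⟩ = IsSubgroupPred (InCyclic-isSubgroupPred a)
  open ≡-Reasoning

  infix 4 _∼_ _∼?_
  record _∼_ (x y : Fin n) : Set where
    constructor coset
    field x⊖y∈H : H (x ⊖ y)

  _∼?_ : ∀ x y → Dec (x ∼ y)
  x ∼? y = map′ coset _∼_.x⊖y∈H (H? (x ⊖ y))

  ∼-refl : ∀ {x} → x ∼ x
  ∼-refl {x} = coset (subst H (sym (⊕-inverseʳ x)) 0ₙ∈)

  ∼-sym : ∀ {x y} → x ∼ y → y ∼ x
  ∼-sym {x} {y} (coset h) = coset (subst H (⁻¹-anti-homo-// x y) (⊖-closed h))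

  ∼-trans : ∀ {x y z} → x ∼ y → y ∼ z → x ∼ z
  ∼-trans {x} {y} {z} (coset h) (coset h′) = coset (subst H
    (trans (⊕-assoc x (⊖ y) (y ⊖ z)) (cong (x ⊕_) (\\-leftDividesʳ y (⊖ z))))
    (⊕-closed h h′))

  ∼-translate : ∀ {x y} c → x ∼ y → x ⊕ c ∼ y ⊕ c
  ∼-translate {x} {y} c (coset h) = coset (subst H (sym (begin
    (x ⊕ c) ⊖ (y ⊕ c)   ≡⟨ [x⊕c]⊖[y⊕d]≡[x⊖y]⊕[c⊖d] x c y c ⟩
    (x ⊖ y) ⊕ (c ⊖ c)   ≡⟨ cong ((x ⊖ y) ⊕_) (⊕-inverseʳ c) ⟩
    (x ⊖ y) ⊕ 0ₙ        ≡⟨ ⊕-identityʳ (x ⊖ y) ⟩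
    x ⊖ y               ∎)) h)

  x⊕c∼x⇒c∈H : ∀ {x c} → x ⊕ c ∼ x → H c
  x⊕c∼x⇒c∈H {x} {c} (coset h) = subst H (xyx⁻¹≈y x c) h

  0ₙ∼b⇒b∈H : ∀ {b} → 0ₙ ∼ b → H b
  0ₙ∼b⇒b∈H {b} (coset h) = subst H (⁻¹-involutive b) (⊖-closed (subst H (⊕-identityˡ (⊖ b)) h))

  does-resp-∼ : ∀ {x y} → x ∼ y → ∀ b → does (x ∼? b) ≡ does (y ∼? b)
  does-resp-∼ {x} {y} x∼y b = does-≡ (x ∼? b) (map′ (∼-trans x∼y) (∼-trans (∼-sym x∼y)) (y ∼? b))

  shift : Bool → Bool → Fin n
  shift true  _     = ⊖ a
  shift false true  = a
  shift false false = 0ₙ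

  offset : Fin n → Fin n
  offset x = shift (does (x ∼? a ⊕ a)) (does (x ∼? a))

  swap : Fin n → Fin n
  swap x = x ⊕ offset x

  offset-top : ∀ {x} → x ∼ a ⊕ a → offset x ≡ ⊖ a
  offset-top {x} x∼2a = cong (λ b → shift b (does (x ∼? a))) (dec-true (x ∼? a ⊕ a) x∼2a)

  offset-mid : ∀ {x} → ¬ x ∼ a ⊕ a → x ∼ a → offset x ≡ a
  offset-mid {x} x≁2a x∼a = cong₂ shift (dec-false (x ∼? a ⊕ a) x≁2a) (dec-true (x ∼? a) x∼a)

  offset-off : ∀ {x} → ¬ x ∼ a ⊕ a → ¬ x ∼ a → offset x ≡ 0ₙ
  offset-off {x} x≁2a x≁a = cong₂ shift (dec-false (x ∼? a ⊕ a) x≁2a) (dec-false (x ∼? a) x≁a)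

  offset-resp-∼ : ∀ {x y} → x ∼ y → offset x ≡ offset y
  offset-resp-∼ x∼y = cong₂ shift (does-resp-∼ x∼y (a ⊕ a)) (does-resp-∼ x∼y a)

  offset∈⟨a⟩ : ∀ x → InCyclic a (offset x)
  offset∈⟨a⟩ x = shift∈⟨a⟩ (does (x ∼? a ⊕ a)) (does (x ∼? a))
    where
    shift∈⟨a⟩ : ∀ b b′ → InCyclic a (shift b b′)
    shift∈⟨a⟩ true  _     = ⟨a⟩.⊖-closed (g∈⟨g⟩ a)
    shift∈⟨a⟩ false true  = g∈⟨g⟩ a
    shift∈⟨a⟩ false false = ⟨a⟩.0ₙ∈

  offset∘swap : ∀ x → offset (swap x) ≡ ⊖ (offset x)
  offset∘swap x = cases (x ∼? a ⊕ a) (x ∼? a)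
    where
    cases : Dec (x ∼ a ⊕ a) → Dec (x ∼ a) → offset (swap x) ≡ ⊖ (offset x)
    cases (yes x∼2a) _ = begin
      offset (x ⊕ offset x) ≡⟨ cong (λ d → offset (x ⊕ d)) (offset-top x∼2a) ⟩
      offset (x ⊖ a)        ≡⟨ offset-mid x⊖a≁2a x⊖a∼a ⟩
      a                     ≡⟨ ⁻¹-involutive a ⟨
      ⊖ (⊖ a)               ≡⟨ cong (λ d → ⊖ d) (offset-top x∼2a) ⟨
      ⊖ (offset x)          ∎
      where
      x⊖a∼a : x ⊖ a ∼ a
      x⊖a∼a = subst (x ⊖ a ∼_) (//-rightDividesʳ a a) (∼-translate (⊖ a) x∼2a)
      x⊖a≁2a : ¬ x ⊖ a ∼ a ⊕ a
      x⊖a≁2a x⊖a∼2a = a∉H (x⊕c∼x⇒c∈H (∼-trans (∼-sym x⊖a∼2a) x⊖a∼a))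
    cases (no x≁2a) (yes x∼a) = begin
      offset (x ⊕ offset x) ≡⟨ cong (λ d → offset (x ⊕ d)) (offset-mid x≁2a x∼a) ⟩
      offset (x ⊕ a)        ≡⟨ offset-top (∼-translate a x∼a) ⟩
      ⊖ a                   ≡⟨ cong (λ d → ⊖ d) (offset-mid x≁2a x∼a) ⟨
      ⊖ (offset x)          ∎
    cases (no x≁2a) (no x≁a) = begin
      offset (x ⊕ offset x) ≡⟨ cong offset (trans (cong (x ⊕_) (offset-off x≁2a x≁a)) (⊕-identityʳ x)) ⟩
      offset x              ≡⟨ offset-off x≁2a x≁a ⟩
      0ₙ                    ≡⟨ ε⁻¹≈ε ⟨
      ⊖ 0ₙ                  ≡⟨ cong (λ d → ⊖ d) (offset-off x≁2a x≁a) ⟨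
      ⊖ (offset x)          ∎

  swap-involutive : ∀ x → swap (swap x) ≡ x
  swap-involutive x = trans (cong (swap x ⊕_) (offset∘swap x)) (//-rightDividesʳ (offset x) x)

  swap-⊖ : ∀ x y → swap y ⊖ swap x ≡ (y ⊖ x) ⊕ (offset y ⊖ offset x)
  swap-⊖ x y = [x⊕c]⊖[y⊕d]≡[x⊖y]⊕[c⊖d] y (offset y) x (offset x)

  swap-resp-∼ : ∀ {x y} → y ∼ x → swap y ⊖ swap x ≡ y ⊖ x
  swap-resp-∼ {x} {y} y∼x = begin
    swap y ⊖ swap x                 ≡⟨ swap-⊖ x y ⟩
    (y ⊖ x) ⊕ (offset y ⊖ offset x) ≡⟨ cong (λ d → (y ⊖ x) ⊕ (d ⊖ offset x)) (offset-resp-∼ y∼x) ⟩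
    (y ⊖ x) ⊕ (offset x ⊖ offset x) ≡⟨ cong ((y ⊖ x) ⊕_) (⊕-inverseʳ (offset x)) ⟩
    (y ⊖ x) ⊕ 0ₙ                    ≡⟨ ⊕-identityʳ (y ⊖ x) ⟩
    y ⊖ x                           ∎

  swap-reflects-∼ : ∀ {x y} → swap y ∼ swap x → y ∼ x
  swap-reflects-∼ {x} {y} sy∼sx@(coset h) = coset (subst H
    (trans (sym (swap-resp-∼ sy∼sx)) (cong₂ _⊖_ (swap-involutive y) (swap-involutive x))) h)

  swap-isCayAut : ∀ {T} → (∀ {d c} → ¬ H d → InCyclic a c → ¬ H (d ⊕ c) → T d → T (d ⊕ c)) →
    IsCayAut T swap
  swap-isCayAut {T} T-invariant = involutive⇒IsCayAut {T} {swap} swap-involutive preserves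
    where
    preserves : ∀ x y → T (y ⊖ x) → T (swap y ⊖ swap x)
    preserves x y t with y ∼? x
    ... | yes y∼x = subst T (sym (swap-resp-∼ y∼x)) t
    ... | no y≁x  = subst T (sym (swap-⊖ x y))
      (T-invariant (y≁x ∘ coset) c∈⟨a⟩ (y≁x ∘ swap-reflects-∼ ∘ coset ∘ subst H (sym (swap-⊖ x y))) t)
      where
      c∈⟨a⟩ = ⟨a⟩.⊕-closed (offset∈⟨a⟩ y) (⟨a⟩.⊖-closed (offset∈⟨a⟩ x))

  swap-fixes-0ₙ : ¬ H (a ⊕ a) → swap 0ₙ ≡ 0ₙ
  swap-fixes-0ₙ 2a∉H = trans
    (cong (0ₙ ⊕_) (offset-off (2a∉H ∘ 0ₙ∼b⇒b∈H) (a∉H ∘ 0ₙ∼b⇒b∈H)))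
    (⊕-identityˡ 0ₙ)

  swap-2a≡a : swap (a ⊕ a) ≡ a
  swap-2a≡a = trans (cong ((a ⊕ a) ⊕_) (offset-top ∼-refl)) (//-rightDividesʳ a a)

  swap-moves-2a : swap (a ⊕ a) ≢ a ⊕ a
  swap-moves-2a eq = a∉H (subst H (sym (identityʳ-unique a a (trans (sym eq) swap-2a≡a))) 0ₙ∈)

module EvenOrder (n t : ℕ) .{{_ : NonZero n}} (n≡t+t : n ≡ t + t) where
  open Zn n
  open ZnGroup n
  open Subgroups n
  open ≡-Reasoning

  t≢0 : t ≢ 0
  t≢0 t≡0 = ≢-nonZero⁻¹ n (trans n≡t+t (cong₂ _+_ t≡0 t≡0))

  toℕ-[t] : toℕ [ t ] ≡ t
  toℕ-[t] = trans (toℕ-[] t) (m<n⇒m%n≡m (subst (t <_) (sym n≡t+t) (m<m+n t (n≢0⇒n>0 t≢0))))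

  [t]≢0ₙ : [ t ] ≢ 0ₙ
  [t]≢0ₙ [t]≡0ₙ = t≢0 (trans (sym toℕ-[t]) (trans (cong toℕ [t]≡0ₙ) toℕ-0ₙ))

  [t]⊕[t]≡0ₙ : [ t ] ⊕ [ t ] ≡ 0ₙ
  [t]⊕[t]≡0ₙ = trans ([]-homo-+ t t) (trans (cong [_] (sym n≡t+t)) [n]≡0ₙ)

  u⊕u≡0ₙ⇒u≡0ₙ⊎u≡[t] : ∀ u → u ⊕ u ≡ 0ₙ → u ≡ 0ₙ ⊎ u ≡ [ t ]
  u⊕u≡0ₙ⇒u≡0ₙ⊎u≡[t] u u⊕u≡0ₙ = from-quotient (m%n≡0⇒n∣m (k + k) n k+k%n≡0)
    where
    k = toℕ u
    k+k%n≡0 : (k + k) % n ≡ 0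
    k+k%n≡0 = trans (sym (toℕ-[] (k + k))) (trans (cong toℕ u⊕u≡0ₙ) toℕ-0ₙ)
    from-quotient : n ∣ k + k → u ≡ 0ₙ ⊎ u ≡ [ t ]
    from-quotient (divides 0 k+k≡0) =
      inj₁ (toℕ-injective (trans (m+n≡0⇒m≡0 k k+k≡0) (sym toℕ-0ₙ)))
    from-quotient (divides 1 k+k≡n) =
      inj₂ (toℕ-injective (trans k≡t (sym toℕ-[t])))
      where
      k≡t : k ≡ t
      k≡t = begin
        k               ≡⟨ n≡⌊n+n/2⌋ k ⟩
        ⌊ k + k /2⌋     ≡⟨ cong ⌊_/2⌋ (trans k+k≡n (trans (+-identityʳ n) n≡t+t)) ⟩
        ⌊ t + t /2⌋     ≡⟨ n≡⌊n+n/2⌋ t ⟨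
        t               ∎
    from-quotient (divides (suc (suc q)) k+k≡[2+q]n) = ⊥-elim (<⇒≱
      (+-mono-< (toℕ<n u) (toℕ<n u))
      (subst (n + n ≤_) (sym k+k≡[2+q]n) (+-monoʳ-≤ n (m≤m+n n (q * n)))))

  module _ {K} (K≤ : IsSubgroup K) (m : ℕ) (∣K∣≡2[1+2m] : ∣ K ∣ ≡ 2 * (1 + 2 * m)) where
    open IsSubgroupPred (∈-isSubgroupPred K≤)
    module 2K = IsSubgroupPred (In2-isSubgroupPred K≤)

    2[1+2m]·k≡0ₙ : ∀ {k} → k ∈ K → (2 * (1 + 2 * m)) · k ≡ 0ₙ
    2[1+2m]·k≡0ₙ {k} k∈K = subst (λ j → j · k ≡ 0ₙ) ∣K∣≡2[1+2m] (∣K∣·a≡0ₙ K≤ k∈K)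

    [t]∉2K : ¬ In2 K [ t ]
    [t]∉2K (k , k∈K , [t]≡k⊕k) = [t]≢0ₙ (begin
      [ t ]                                   ≡⟨ [1+2m]·u≡u m [t]⊕[t]≡0ₙ ⟨
      (1 + 2 * m) · [ t ]                     ≡⟨ cong ((1 + 2 * m) ·_) [t]≡k⊕k ⟩
      (1 + 2 * m) · (k ⊕ k)                   ≡⟨ ×-distrib-+ k k (1 + 2 * m) ⟩
      ((1 + 2 * m) · k) ⊕ ((1 + 2 * m) · k)   ≡⟨ ·-double (1 + 2 * m) k ⟩
      (2 * (1 + 2 * m)) · k                   ≡⟨ 2[1+2m]·k≡0ₙ k∈K ⟩
      0ₙ                                      ∎)

    [2j]·k∈2K : ∀ j {k} → k ∈ K → In2 K ((2 * j) · k)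
    [2j]·k∈2K j {k} k∈K = j · k , ·-closed j k∈K , sym (·-double j k)

    [2+2m]·k∈2K : ∀ {k} → k ∈ K → In2 K ((2 + 2 * m) · k)
    [2+2m]·k∈2K {k} k∈K = subst (λ j → In2 K (j · k)) (*-distribˡ-+ 2 1 m) ([2j]·k∈2K (1 + m) k∈K)

    Ko⊕[t]∈2K : ∀ {k} → InKo K k → In2 K (k ⊕ [ t ])
    Ko⊕[t]∈2K {k} (k∈K , k∉2K) with u⊕u≡0ₙ⇒u≡0ₙ⊎u≡[t] ((1 + 2 * m) · k)
      (trans (·-double (1 + 2 * m) k) (2[1+2m]·k≡0ₙ k∈K))
    ... | inj₁ u≡0ₙ  =
      ⊥-elim (k∉2K (subst (In2 K) (trans (cong (k ⊕_) u≡0ₙ) (⊕-identityʳ k)) ([2+2m]·k∈2K k∈K)))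
    ... | inj₂ u≡[t] = subst (In2 K) (cong (k ⊕_) u≡[t]) ([2+2m]·k∈2K k∈K)

    ShiftedConn : Subset n → Fin n → Set
    ShiftedConn S z = Σ (Fin n) λ s → s ∈ S × s ≢ [ t ] × z ≡ s ⊕ [ t ]

    module _ {S g} (hyp : ∀ s y → s ∈ S → ¬ InKo K s → InCyclic g y → (s ⊕ y ∈ S ⊎ InKo K (s ⊕ y))) where

      ShiftedConn-translate : ∀ {s c} → s ∈ S → ¬ In2 K (s ⊕ [ t ]) → InCyclic g c →
        ¬ In2 K ((s ⊕ c) ⊕ [ t ]) → ShiftedConn S ((s ⊕ c) ⊕ [ t ])
      ShiftedConn-translate {s} {c} s∈S s⊕[t]∉2K c∈⟨g⟩ s⊕c⊕[t]∉2K
        with hyp s c s∈S (s⊕[t]∉2K ∘ Ko⊕[t]∈2K) c∈⟨g⟩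
      ... | inj₁ s⊕c∈S = s ⊕ c , s⊕c∈S , s⊕c≢[t] , refl
        where
        s⊕c≢[t] : s ⊕ c ≢ [ t ]
        s⊕c≢[t] s⊕c≡[t] = s⊕c⊕[t]∉2K
          (subst (In2 K) (sym (trans (cong (_⊕ [ t ]) s⊕c≡[t]) [t]⊕[t]≡0ₙ)) 2K.0ₙ∈)
      ... | inj₂ s⊕c∈Ko = ⊥-elim (s⊕c⊕[t]∉2K (Ko⊕[t]∈2K s⊕c∈Ko))

      ShiftedConn-invariant : ∀ {d c} → ¬ In2 K d → InCyclic g c → ¬ In2 K (d ⊕ c) →
        ShiftedConn S d → ShiftedConn S (d ⊕ c)
      ShiftedConn-invariant {c = c} d∉2K c∈⟨g⟩ d⊕c∉2K (s , s∈S , _ , refl) =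
        subst (ShiftedConn S) (sym rearrange)
          (ShiftedConn-translate s∈S d∉2K c∈⟨g⟩ (d⊕c∉2K ∘ subst (In2 K) (sym rearrange)))
        where
        rearrange : (s ⊕ [ t ]) ⊕ c ≡ (s ⊕ c) ⊕ [ t ]
        rearrange = xy∙z≈xz∙y s [ t ] c

lemma7p5 : (h : ℕ) → .{{_ : NonZero h}} → .{{_ : NonZero (4 * h)}} →
    let open Zn (4 * h) in
    (S K : Subset (4 * h)) →
    InverseClosed S →
    IsSubgroup K →
    OrderTwiceOdd K →
    (∀ s y → s ∈ S → ¬ InKo K s → InCyclic [ h ] y → (s ⊕ y ∈ S ⊎ InKo K (s ⊕ y))) →
    Σ (Fin (4 * h) ⤖ Fin (4 * h)) λ f →
      IsCayAut (λ z → Σ (Fin (4 * h)) λ s → s ∈ S × s ≢ [ 2 * h ] × z ≡ s ⊕ [ 2 * h ]) (Bijection.to f)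
      × Bijection.to f 0ₙ ≡ 0ₙ
      × Bijection.to f [ 2 * h ] ≢ [ 2 * h ]
lemma7p5 h S K _ K≤ (m , ∣K∣≡2[1+2m]) hyp =
  ↔⇒⤖ (mk↔ₛ′ swap swap swap-involutive swap-involutive) ,
  swap-isCayAut (ShiftedConn-invariant K≤ m ∣K∣≡2[1+2m] hyp) ,
  swap-fixes-0ₙ (2h∉2K ∘ subst (In2 K) [h]⊕[h]≡[2h]) ,
  subst (λ x → swap x ≢ x) [h]⊕[h]≡[2h] swap-moves-2a
  where
  open Zn (4 * h)
  open ZnGroup (4 * h)
  open Subgroups (4 * h)
  open EvenOrder (4 * h) (2 * h) (*-distribʳ-+ h 2 2)

  2h∉2K : ¬ In2 K [ 2 * h ]
  2h∉2K = [t]∉2K K≤ m ∣K∣≡2[1+2m]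

  [h]⊕[h]≡[2h] : [ h ] ⊕ [ h ] ≡ [ 2 * h ]
  [h]⊕[h]≡[2h] = trans ([]-homo-+ h h) (cong (λ k → [ h + k ]) (sym (+-identityʳ h)))

  [h]∉2K : ¬ In2 K [ h ]
  [h]∉2K h∈2K = 2h∉2K (subst (In2 K) [h]⊕[h]≡[2h]
    (IsSubgroupPred.⊕-closed (In2-isSubgroupPred K≤) h∈2K h∈2K))

  open CosetSwap (4 * h) (In2-isSubgroupPred K≤) (In2? K) [h]∉2K
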